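{- There exist two finite connected graphs $G$ and $G'$ (without loops or multiple edges) such that $T_G(x,y) = T_{G'}(x,y)$ and $\operatorname{Jac}(G) \cong \operatorname{Jac}(G')$ as abelian groups, but $Z_G(t,u) \neq Z_{G'}(t,u)$.
   Context: All graphs are finite, connected, without loops or multiple edges. $T_G(x,y)$ denotes the Tutte polynomial of $G$. For a graph $G$ with vertices $v_1,\dots,v_n$, a divisor is a formal sum $D=\sum a_i v_i$ with $a_i\in\mathbb{Z}$, of degree $\deg D=\sum a_i$; it is effective if all $a_i\ge 0$. The combinatorial Laplacian $\Delta(G)$ is the degree matrix minus the adjacency matrix; $\operatorname{Pic}(G)$ is the cokernel of $\Delta(G):\mathbb{Z}^n\to\mathbb{Z}^n$ (divisors modulo the image of the Laplacian; two divisors are linearly equivalent if they have the same class), and $\operatorname{Jac}(G)$ is the subgroup of $\operatorname{Pic}(G)$ of classes of degree $0$. The Baker–Norine rank $r(D)$ is $-1$ if $D$ is not linearly equivalent to an effective divisor, and otherwise the largest integer $r\ge 0$ such that for every effective divisor $E$ of degree $r$, $D-E$ is linearly equivalent to an effective divisor; it depends only on the class $[D]$. Set $h(D)=r(D)+1$. Lorenzini's two-variable zeta function is $Z_G(t,u)=\sum_{[D]\in\operatorname{Pic}(G)} \frac{u^{h(D)}-1}{u-1}\, t^{\deg D}$ (a rational function in $t,u$). -}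

module Defs where

open import Level using (0ℓ)
open import Data.Bool using (Bool; true; false; _∧_; _∨_; not; T)
open import Data.Nat as ℕ using (ℕ; zero; suc; _∸_)
open import Data.Nat.Combinatorics using (_C_)
open import Data.Integer as ℤ using (ℤ; +_; 0ℤ; -_; _-_)
import Data.Integer.Properties as ℤP
open import Data.Fin as Fin using (Fin)
open import Data.Fin.Properties using (_≟_)
open import Data.Product using (Σ; ∃; _×_; _,_; proj₁; proj₂)
open import Data.List using (List; []; _∷_; length; map; foldr; _++_)
open import Data.Bool.ListAction using (any)
open import Data.List.Relation.Unary.All using (All)
open import Data.List.Relation.Unary.Any using (Any)
open import Data.List.Relation.Unary.AllPairs using (AllPairs)
open import Data.List.Relation.Unary.Unique.Propositional using (Unique)
open import Relation.Nullary using (¬_)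
open import Relation.Nullary.Decidable using (⌊_⌋)
open import Relation.Binary.PropositionalEquality using (_≡_; refl; cong; cong₂; sym; trans)
open import Algebra.Bundles.Raw using (RawGroup)
open import Algebra.Morphism.Structures using (module GroupMorphisms)

-- Each edge {u,v} is stored once as an ordered pair (u , v) with u < v
-- (so there are no loops), and the list of edges has no duplicates
-- (so there are no multiple edges).

Edge : ℕ → Set
Edge n = Fin n × Fin n

reachIn : {n : ℕ} → ℕ → List (Edge n) → Fin n → Fin n → Bool
reachIn zero    A u v = ⌊ u ≟ v ⌋
reachIn (suc k) A u v =
  reachIn k A u v ∨
  any (λ e → (reachIn k A u (proj₁ e) ∧ ⌊ proj₂ e ≟ v ⌋)
           ∨ (reachIn k A u (proj₂ e) ∧ ⌊ proj₁ e ≟ v ⌋)) A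

-- In a graph on n vertices, reachable = reachable by a walk of length ≤ n.
reach : {n : ℕ} → List (Edge n) → Fin n → Fin n → Bool
reach {n} A = reachIn n A

record Graph : Set where
  field
    n         : ℕ
    edges     : List (Edge n)
    noLoops   : All (λ e → proj₁ e Fin.< proj₂ e) edges
    simple    : Unique edges
    nonempty  : 0 ℕ.< n
    connected : ∀ u v → T (reach edges u v)
open Graph public

-- Tutte polynomial  T_G(x,y) = Σ_{A ⊆ E} (x-1)^{r(E)-r(A)} (y-1)^{|A|-r(A)},
-- where r(A) = n - (number of connected components of (V,A)).

sublists : {X : Set} → List X → List (List X)
sublists []       = [] ∷ []
sublists (x ∷ xs) = let s = sublists xs in s ++ (map (x ∷_) s)

countFin : (n : ℕ) → (Fin n → Bool) → ℕ
countFin zero    p = 0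
countFin (suc n) p = (if p Fin.zero then 1 else 0) ℕ.+ countFin n (λ i → p (Fin.suc i))
  where open import Data.Bool using (if_then_else_)

-- number of connected components: vertices that are the least vertex
-- of their component
components : {n : ℕ} → List (Edge n) → ℕ
components {n} A =
  countFin n (λ v → not (anyFin (λ u → ⌊ u Fin.<? v ⌋ ∧ reach A u v)))
  where
    anyFin : {m : ℕ} → (Fin m → Bool) → Bool
    anyFin {zero}  p = false
    anyFin {suc m} p = p Fin.zero ∨ anyFin (λ i → p (Fin.suc i))

rank : {n : ℕ} → List (Edge n) → ℕ
rank {n} A = n ∸ components A

sumℤ : {X : Set} → List X → (X → ℤ) → ℤ
sumℤ xs f = foldr (λ x s → f x ℤ.+ s) 0ℤ xs

coeffPow : ℕ → ℕ → ℤ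
coeffPow a i = (+ (a C i)) ℤ.* ((ℤ.-1ℤ) ℤ.^ (a ∸ i))

tutteCoeff : Graph → ℕ → ℕ → ℤ
tutteCoeff G i j =
  sumℤ (sublists (edges G)) (λ A →
    coeffPow (rank (edges G) ∸ rank A) i ℤ.* coeffPow (length A ∸ rank A) j)

TutteEq : Graph → Graph → Set
TutteEq G G' = ∀ i j → tutteCoeff G i j ≡ tutteCoeff G' i j

Div : ℕ → Set
Div n = Fin n → ℤ

deg : {n : ℕ} → Div n → ℤ
deg {zero}  D = 0ℤ
deg {suc n} D = D Fin.zero ℤ.+ deg (λ i → D (Fin.suc i))

_⊕_ : {n : ℕ} → Div n → Div n → Div n
(D ⊕ E) i = D i ℤ.+ E i

_⊖_ : {n : ℕ} → Div n → Div n → Div n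
(D ⊖ E) i = D i - E i

⊝_ : {n : ℕ} → Div n → Div n
(⊝ D) i = - D i

zeroDiv : {n : ℕ} → Div n
zeroDiv i = 0ℤ

Effective : {n : ℕ} → Div n → Set
Effective D = ∀ i → 0ℤ ℤ.≤ D i

δ : {n : ℕ} → Fin n → Fin n → ℤ
δ u i = if ⌊ u ≟ i ⌋ then ℤ.1ℤ else 0ℤ
  where open import Data.Bool using (if_then_else_)

laplacian : (G : Graph) → Div (n G) → Div (n G)
laplacian G z i =
  sumℤ (edges G) (λ e → δ (proj₁ e) i ℤ.* (z (proj₁ e) - z (proj₂ e))
                      ℤ.+ δ (proj₂ e) i ℤ.* (z (proj₂ e) - z (proj₁ e)))

LinEq : (G : Graph) → Div (n G) → Div (n G) → Set
LinEq G D D' = ∃ λ (z : Div (n G)) → ∀ i → D i - D' i ≡ laplacian G z i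

deg-⊕ : {n : ℕ} (D E : Div n) → deg (D ⊕ E) ≡ deg D ℤ.+ deg E
deg-⊕ {zero}  D E = refl
deg-⊕ {suc n} D E =
  trans (cong (λ x → (D Fin.zero ℤ.+ E Fin.zero) ℤ.+ x) (deg-⊕ (λ i → D (Fin.suc i)) (λ i → E (Fin.suc i))))
        (CS.interchange (D Fin.zero) (E Fin.zero) (deg (λ i → D (Fin.suc i))) (deg (λ i → E (Fin.suc i))))
  where import Algebra.Properties.CommutativeSemigroup ℤP.+-commutativeSemigroup as CS

deg-⊝ : {n : ℕ} (D : Div n) → deg (⊝ D) ≡ - deg D
deg-⊝ {zero}  D = refl
deg-⊝ {suc n} D =
  trans (cong (λ x → (- D Fin.zero) ℤ.+ x) (deg-⊝ (λ i → D (Fin.suc i))))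
        (sym (ℤP.neg-distrib-+ (D Fin.zero) (deg (λ i → D (Fin.suc i)))))

deg-zero : (n : ℕ) → deg (zeroDiv {n}) ≡ 0ℤ
deg-zero zero    = refl
deg-zero (suc n) = trans (ℤP.+-identityˡ (deg (zeroDiv {n}))) (deg-zero n)

Div₀ : ℕ → Set
Div₀ n = Σ (Div n) (λ D → deg D ≡ 0ℤ)

Jac : Graph → RawGroup 0ℓ 0ℓ
Jac G = record
  { Carrier = Div₀ (n G)
  ; _≈_     = λ D E → LinEq G (proj₁ D) (proj₁ E)
  ; _∙_     = λ D E → (proj₁ D ⊕ proj₁ E) ,
                trans (deg-⊕ (proj₁ D) (proj₁ E)) (cong₂ ℤ._+_ (proj₂ D) (proj₂ E))
  ; ε       = zeroDiv , deg-zero (n G)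
  ; _⁻¹     = λ D → (⊝ proj₁ D) , trans (deg-⊝ (proj₁ D)) (cong -_ (proj₂ D))
  }

JacIso : Graph → Graph → Set
JacIso G G' = Σ (RawGroup.Carrier (Jac G) → RawGroup.Carrier (Jac G'))
                (GroupMorphisms.IsGroupIsomorphism (Jac G) (Jac G'))

-- RankGE G D k  means  r(D) ≥ k  (for k ≥ 0), i.e.
-- for every effective E of degree k, D - E is linearly equivalent to an
-- effective divisor.  (r(D) ≥ 0 iff D ~ effective: the case k = 0.)
-- Since h(D) = r(D) + 1, for k : ℕ we have  h(D) > k  iff  RankGE G D k.

RankGE : (G : Graph) → Div (n G) → ℕ → Set
RankGE G D k = ∀ (E : Div (n G)) → Effective E → deg E ≡ + k →
               ∃ λ (F : Div (n G)) → Effective F × LinEq G (D ⊖ E) F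

-- Expanding (u^h - 1)/(u - 1) = 1 + u + … + u^{h-1},
--   Z_G(t,u) = Σ_{d,k} c_G(d,k) t^d u^k,
-- where c_G(d,k) = #{ [D] ∈ Pic(G) : deg D = d, h(D) > k }.
-- ZetaCoeff G d k m  says  c_G(d,k) = m: there is a list of m divisors of
-- degree d with h > k, pairwise non-equivalent, representing every class
-- of degree d with h > k.

ZetaCoeff : (G : Graph) → ℤ → ℕ → ℕ → Set
ZetaCoeff G d k m =
  Σ (List (Div (n G))) λ L →
    length L ≡ m ×
    All (λ D → deg D ≡ d × RankGE G D k) L ×
    AllPairs (λ D D' → ¬ LinEq G D D') L ×
    (∀ (D : Div (n G)) → deg D ≡ d → RankGE G D k → Any (λ D' → LinEq G D D') L)

ZetaDiffer : Graph → Graph → Set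
ZetaDiffer G G' =
  ∃ λ (d : ℤ) → ∃ λ (k : ℕ) → ∃ λ (m : ℕ) → ∃ λ (m' : ℕ) →
    ZetaCoeff G d k m × ZetaCoeff G' d k m' × ¬ (m ≡ m')

-- G₁ and G₂ both glue a triangle onto the diamond K₄ − e at a single vertex: G₁ at a vertex
-- of degree 3, G₂ at a vertex of degree 2. As one-point unions of the same two blocks they
-- have the same cycle matroid (corresponding edge subsets have equal rank and size), hence
-- the same Tutte polynomial, and Jac ≅ ℤ/8 × ℤ/3 ≅ ℤ/24 for both.
--
-- For each graph a weight vector c, harmonic modulo 24, identifies Jac with ℤ/24 through
-- ψ(D) = Σ cᵢ Dᵢ, so that D ~ D′ iff deg D = deg D′ and ψ(D) ≡ ψ(D′). A divisor D of degree 2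
-- has rank ≥ 1 iff every D − v is equivalent to a single vertex w, i.e. iff for every v there
-- is a w with ψ(D) ≡ c_v + c_w. Checking the finitely many candidates shows that G₂ has exactly
-- one such class (that of v₀ + v₁) and G₁ none, so the coefficients of t² u in Z_{G₁} and
-- Z_{G₂} differ.

module Submission where

open import Agda.Builtin.FromNat
open import Agda.Builtin.FromNeg
import Data.Nat.Literals as ℕLiterals
import Data.Integer.Literals as ℤLiterals
open import Data.Unit using (tt)
open import Defs
open import Algebra.Bundles.Raw using (RawGroup)
open import Data.Bool using (Bool; false; _∧_; _∨_; not; T; if_then_else_)
open import Data.Bool.ListAction using (any; or)
open import Data.Empty using (⊥; ⊥-elim)
open import Data.Fin as Fin using (Fin; zero; suc; #_)
open import Data.Fin.Properties using (_≟_; suc-injective; all?; any?)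
open import Data.Integer as ℤ using (ℤ; +_; 0ℤ; 1ℤ; _+_; _*_; _-_; -_; +≤+; _≤_)
import Data.Integer.Properties as ℤP
open import Data.Integer.Divisibility.Signed using (_∣_; _∣?_; divides; ∣m∣n⇒∣m+n; ∣n⇒∣m*n; ∣m⇒∣-m)
open import Data.Integer.Tactic.RingSolver using (solve-∀)
open import Data.List using (List; []; _∷_; length)
open import Data.List.Properties using (map-cong)
open import Data.List.Relation.Binary.Pointwise as Pointwise using (Pointwise; []; _∷_)
import Data.List.Relation.Unary.All as All
open import Data.List.Relation.Unary.All using ([]; _∷_)
open import Data.List.Relation.Unary.AllPairs using (allPairs?; []; _∷_)
open import Data.List.Relation.Unary.Any using (here)
open import Data.Nat as ℕ using (ℕ; zero; suc; _∸_; s≤s; z≤n)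
open import Data.Product using (Σ; ∃; _×_; _,_; proj₁; proj₂)
import Data.Product.Properties as ×
open import Data.Sum using (_⊎_; inj₁; inj₂)
open import Data.Vec using (Vec; []; _∷_; lookup; tabulate)
open import Data.Vec.Properties using (lookup∘tabulate)
open import Relation.Nullary using (¬_; ¬?; Dec)
open import Relation.Nullary.Decidable using (⌊_⌋; ⌊⌋-map′; True; toWitness; T?; from-yes; _×-dec_; _→-dec_)
open import Relation.Binary.PropositionalEquality

instance
  ℕ-number   = ℕLiterals.number
  ℤ-number   = ℤLiterals.number
  ℤ-negative = ℤLiterals.negative

private variable m k : ℕ

-- Divisors and the pairing ⟨ c , D ⟩ = Σ cᵢ Dᵢ

deg-cong : {D E : Div m} → D ≗ E → deg D ≡ deg E
deg-cong {zero}  eq = refl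
deg-cong {suc m} eq = cong₂ _+_ (eq zero) (deg-cong (λ i → eq (suc i)))

deg-⊖ : (D E : Div m) → deg (D ⊖ E) ≡ deg D - deg E
deg-⊖ D E = trans (deg-⊕ D (⊝ E)) (cong (λ x → deg D + x) (deg-⊝ E))

deg-scale : (a : ℤ) (D : Div m) → deg (λ i → a * D i) ≡ a * deg D
deg-scale {zero}  a D = sym (ℤP.*-zeroʳ a)
deg-scale {suc m} a D =
  trans (cong (λ x → a * D zero + x) (deg-scale a (λ i → D (suc i))))
        (sym (ℤP.*-distribˡ-+ a (D zero) (deg (λ i → D (suc i)))))

δ-suc : (u v : Fin m) → δ (suc u) (suc v) ≡ δ u v
δ-suc u v = cong (λ b → if b then 1ℤ else 0ℤ) (⌊⌋-map′ (cong suc) suc-injective (u ≟ v))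

δ-comm : (u v : Fin m) → δ u v ≡ δ v u
δ-comm zero    zero    = refl
δ-comm zero    (suc v) = refl
δ-comm (suc u) zero    = refl
δ-comm (suc u) (suc v) = trans (δ-suc u v) (trans (δ-comm u v) (sym (δ-suc v u)))

deg-δ* : (w : Fin m) (D : Div m) → deg (λ i → δ w i * D i) ≡ D w
deg-δ* {suc m} zero D =
  trans (cong₂ _+_ (ℤP.*-identityˡ (D zero))
                   (trans (deg-cong (λ i → ℤP.*-zeroˡ (D (suc i)))) (deg-zero m)))
        (ℤP.+-identityʳ (D zero))
deg-δ* {suc m} (suc w) D =
  trans (cong₂ _+_ (ℤP.*-zeroˡ (D zero)) (deg-cong (λ i → cong (_* D (suc i)) (δ-suc w i))))
        (trans (ℤP.+-identityˡ _) (deg-δ* w (λ i → D (suc i))))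

⟨_,_⟩ : Div m → Div m → ℤ
⟨ c , D ⟩ = deg (λ i → c i * D i)

⟨⟩-congʳ : (c : Div m) {D E : Div m} → D ≗ E → ⟨ c , D ⟩ ≡ ⟨ c , E ⟩
⟨⟩-congʳ c eq = deg-cong (λ i → cong (c i *_) (eq i))

⟨⟩-zeroʳ : (c : Div m) → ⟨ c , zeroDiv ⟩ ≡ 0ℤ
⟨⟩-zeroʳ {m} c = trans (deg-cong (λ i → ℤP.*-zeroʳ (c i))) (deg-zero m)

⟨⟩-⊕ʳ : (c D E : Div m) → ⟨ c , D ⊕ E ⟩ ≡ ⟨ c , D ⟩ + ⟨ c , E ⟩
⟨⟩-⊕ʳ c D E = trans (deg-cong (λ i → ℤP.*-distribˡ-+ (c i) (D i) (E i)))
                    (deg-⊕ (λ i → c i * D i) (λ i → c i * E i))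

⟨⟩-⊝ʳ : (c D : Div m) → ⟨ c , ⊝ D ⟩ ≡ - ⟨ c , D ⟩
⟨⟩-⊝ʳ c D = trans (deg-cong (λ i → sym (ℤP.neg-distribʳ-* (c i) (D i))))
                  (deg-⊝ (λ i → c i * D i))

⟨⟩-⊖ʳ : (c D E : Div m) → ⟨ c , D ⊖ E ⟩ ≡ ⟨ c , D ⟩ - ⟨ c , E ⟩
⟨⟩-⊖ʳ c D E = trans (⟨⟩-⊕ʳ c D (⊝ E)) (cong (λ x → ⟨ c , D ⟩ + x) (⟨⟩-⊝ʳ c E))

⟨⟩-scaleʳ : (c : Div m) (a : ℤ) (D : Div m) → ⟨ c , (λ i → a * D i) ⟩ ≡ a * ⟨ c , D ⟩
⟨⟩-scaleʳ c a D = trans (deg-cong (λ i → lemma (c i) (D i))) (deg-scale a (λ i → c i * D i))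
  where
  lemma : ∀ x y → x * (a * y) ≡ a * (x * y)
  lemma x y = trans (sym (ℤP.*-assoc x a y)) (trans (cong (_* y) (ℤP.*-comm x a)) (ℤP.*-assoc a x y))

⟨⟩-δʳ : (c : Div m) (w : Fin m) → ⟨ c , δ w ⟩ ≡ c w
⟨⟩-δʳ c w = trans (deg-cong (λ i → ℤP.*-comm (c i) (δ w i))) (deg-δ* w c)

∣-⟨⟩ : {a : ℤ} (c : Div m) {D : Div m} → (∀ i → a ∣ D i) → a ∣ ⟨ c , D ⟩
∣-⟨⟩ {zero}  {a} c a∣D = divides 0ℤ (sym (ℤP.*-zeroˡ a))
∣-⟨⟩ {suc m} c a∣D =
  ∣m∣n⇒∣m+n (∣n⇒∣m*n (c zero) (a∣D zero)) (∣-⟨⟩ (λ i → c (suc i)) (λ i → a∣D (suc i)))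

-- The Laplacian

module _ {X : Set} where

  sumℤ-cong : (xs : List X) {f g : X → ℤ} → f ≗ g → sumℤ xs f ≡ sumℤ xs g
  sumℤ-cong []       eq = refl
  sumℤ-cong (x ∷ xs) eq = cong₂ _+_ (eq x) (sumℤ-cong xs eq)

  sumℤ-+ : (xs : List X) (f g : X → ℤ) → sumℤ xs (λ x → f x + g x) ≡ sumℤ xs f + sumℤ xs g
  sumℤ-+ []       f g = refl
  sumℤ-+ (x ∷ xs) f g =
    trans (cong (λ s → f x + g x + s) (sumℤ-+ xs f g))
          (+-interchange (f x) (g x) (sumℤ xs f) (sumℤ xs g))
    where open import Algebra.Properties.CommutativeSemigroup ℤP.+-commutativeSemigroup
                 using () renaming (interchange to +-interchange)

  sumℤ-scale : (xs : List X) (a : ℤ) (f : X → ℤ) → sumℤ xs (λ x → a * f x) ≡ a * sumℤ xs f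
  sumℤ-scale []       a f = sym (ℤP.*-zeroʳ a)
  sumℤ-scale (x ∷ xs) a f =
    trans (cong (λ s → a * f x + s) (sumℤ-scale xs a f)) (sym (ℤP.*-distribˡ-+ a (f x) (sumℤ xs f)))

  deg-sumℤ : (xs : List X) (F : X → Div m) → deg (λ i → sumℤ xs (λ x → F x i)) ≡ sumℤ xs (λ x → deg (F x))
  deg-sumℤ {m} []       F = deg-zero m
  deg-sumℤ     (x ∷ xs) F =
    trans (deg-⊕ (F x) (λ i → sumℤ xs (λ y → F y i))) (cong (λ s → deg (F x) + s) (deg-sumℤ xs F))

module _ (G : Graph) where

  laplacian-⊕ : (z w : Div (n G)) → laplacian G (z ⊕ w) ≗ laplacian G z ⊕ laplacian G w
  laplacian-⊕ z w j =
    trans (sumℤ-cong (edges G) (λ (u , v) → edge (δ u j) (δ v j) (z u) (z v) (w u) (w v)))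
          (sumℤ-+ (edges G) (λ (u , v) → δ u j * (z u - z v) + δ v j * (z v - z u))
                            (λ (u , v) → δ u j * (w u - w v) + δ v j * (w v - w u)))
    where
    edge : ∀ a b zu zv wu wv →
           a * ((zu + wu) - (zv + wv)) + b * ((zv + wv) - (zu + wu)) ≡
           (a * (zu - zv) + b * (zv - zu)) + (a * (wu - wv) + b * (wv - wu))
    edge = solve-∀

  laplacian-scale : (k : ℤ) (z : Div (n G)) → laplacian G (λ i → k * z i) ≗ λ j → k * laplacian G z j
  laplacian-scale k z j =
    trans (sumℤ-cong (edges G) (λ (u , v) → edge k (δ u j) (δ v j) (z u) (z v)))
          (sumℤ-scale (edges G) k (λ (u , v) → δ u j * (z u - z v) + δ v j * (z v - z u)))
    where
    edge : ∀ k a b zu zv → a * (k * zu - k * zv) + b * (k * zv - k * zu) ≡ k * (a * (zu - zv) + b * (zv - zu))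
    edge = solve-∀

  laplacian-zero : laplacian G zeroDiv ≗ zeroDiv
  laplacian-zero j = trans (laplacian-scale 0ℤ zeroDiv j) (ℤP.*-zeroˡ (laplacian G zeroDiv j))

  laplacian-Σ : (F : Fin k → Div (n G)) →
                laplacian G (λ j → deg (λ i → F i j)) ≗ λ j → deg (λ i → laplacian G (F i) j)
  laplacian-Σ {zero}  F j = laplacian-zero j
  laplacian-Σ {suc k} F j =
    trans (laplacian-⊕ (F zero) (λ j → deg (λ i → F (suc i) j)) j)
          (cong (λ s → laplacian G (F zero) j + s) (laplacian-Σ (λ i → F (suc i)) j))

  ⟨⟩-laplacian : (c z : Div (n G)) →
    ⟨ c , laplacian G z ⟩ ≡ sumℤ (edges G) (λ (u , v) → (c u - c v) * (z u - z v))
  ⟨⟩-laplacian c z = begin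
    deg (λ i → c i * laplacian G z i)
      ≡⟨ deg-cong (λ i → sym (sumℤ-scale (edges G) (c i) _)) ⟩
    deg (λ i → sumℤ (edges G) λ (u , v) → c i * (δ u i * (z u - z v) + δ v i * (z v - z u)))
      ≡⟨ deg-sumℤ (edges G) (λ (u , v) i → c i * (δ u i * (z u - z v) + δ v i * (z v - z u))) ⟩
    sumℤ (edges G) (λ (u , v) → deg λ i → c i * (δ u i * (z u - z v) + δ v i * (z v - z u)))
      ≡⟨ sumℤ-cong (edges G) (λ (u , v) → edge u v) ⟩
    sumℤ (edges G) (λ (u , v) → (c u - c v) * (z u - z v)) ∎
    where
    open ≡-Reasoning
    edge : ∀ u v → deg (λ i → c i * (δ u i * (z u - z v) + δ v i * (z v - z u))) ≡ (c u - c v) * (z u - z v)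
    edge u v = begin
      deg (λ i → c i * (δ u i * (z u - z v) + δ v i * (z v - z u)))
        ≡⟨ deg-cong (λ i → distrib (c i) (δ u i) (δ v i) (z u - z v) (z v - z u)) ⟩
      deg (λ i → δ u i * ((z u - z v) * c i) + δ v i * ((z v - z u) * c i))
        ≡⟨ deg-⊕ (λ i → δ u i * ((z u - z v) * c i)) (λ i → δ v i * ((z v - z u) * c i)) ⟩
      deg (λ i → δ u i * ((z u - z v) * c i)) + deg (λ i → δ v i * ((z v - z u) * c i))
        ≡⟨ cong₂ _+_ (deg-δ* u _) (deg-δ* v _) ⟩
      (z u - z v) * c u + (z v - z u) * c v
        ≡⟨ regroup (c u) (c v) (z u) (z v) ⟩
      (c u - c v) * (z u - z v) ∎
      where
      distrib : ∀ x a b p q → x * (a * p + b * q) ≡ a * (p * x) + b * (q * x)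
      distrib = solve-∀
      regroup : ∀ cu cv zu zv → (zu - zv) * cu + (zv - zu) * cv ≡ (cu - cv) * (zu - zv)
      regroup = solve-∀

  laplacian-self-adjoint : (c z : Div (n G)) → ⟨ c , laplacian G z ⟩ ≡ ⟨ z , laplacian G c ⟩
  laplacian-self-adjoint c z =
    trans (⟨⟩-laplacian c z)
          (trans (sumℤ-cong (edges G) (λ (u , v) → ℤP.*-comm (c u - c v) (z u - z v)))
                 (sym (⟨⟩-laplacian z c)))

  deg-laplacian : (z : Div (n G)) → deg (laplacian G z) ≡ 0ℤ
  deg-laplacian z = begin
    deg (laplacian G z)
      ≡⟨ deg-cong (λ i → sym (ℤP.*-identityˡ (laplacian G z i))) ⟩
    ⟨ (λ _ → 1ℤ) , laplacian G z ⟩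
      ≡⟨ ⟨⟩-laplacian (λ _ → 1ℤ) z ⟩
    sumℤ (edges G) (λ (u , v) → 0ℤ * (z u - z v))
      ≡⟨ sumℤ-scale (edges G) 0ℤ (λ (u , v) → z u - z v) ⟩
    0ℤ * sumℤ (edges G) (λ (u , v) → z u - z v)
      ≡⟨ ℤP.*-zeroˡ (sumℤ (edges G) (λ (u , v) → z u - z v)) ⟩
    0ℤ ∎
    where open ≡-Reasoning

  ∣⟨⟩-laplacian : {a : ℤ} (c : Div (n G)) → (∀ i → a ∣ laplacian G c i) →
                  (z : Div (n G)) → a ∣ ⟨ c , laplacian G z ⟩
  ∣⟨⟩-laplacian {a} c a∣Δc z = subst (a ∣_) (sym (laplacian-self-adjoint c z)) (∣-⟨⟩ z a∣Δc)

  linEq-resp : {D D′ E E′ : Div (n G)} → D ≗ D′ → E ≗ E′ → LinEq G D E → LinEq G D′ E′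
  linEq-resp D≗D′ E≗E′ (z , Δz) = z , λ i → trans (cong₂ _-_ (sym (D≗D′ i)) (sym (E≗E′ i))) (Δz i)

  linEq⇒deg≡ : {D E : Div (n G)} → LinEq G D E → deg D ≡ deg E
  linEq⇒deg≡ {D} {E} (z , Δz) =
    ℤP.i-j≡0⇒i≡j (deg D) (deg E) (trans (sym (deg-⊖ D E)) (trans (deg-cong Δz) (deg-laplacian z)))

-- Effective divisors, rank ≥ 1 in degree 2, and zeta coefficients

δ-effective : (w : Fin m) → Effective (δ w)
δ-effective zero    zero    = +≤+ z≤n
δ-effective zero    (suc i) = +≤+ z≤n
δ-effective (suc w) zero    = +≤+ z≤n
δ-effective (suc w) (suc i) = subst (0ℤ ≤_) (sym (δ-suc w i)) (δ-effective w i)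

deg-δ : (w : Fin m) → deg (δ w) ≡ 1ℤ
deg-δ w = trans (deg-cong (λ i → sym (ℤP.*-identityʳ (δ w i)))) (deg-δ* w (λ _ → 1ℤ))

deg-nonneg : {D : Div m} → Effective D → 0ℤ ≤ deg D
deg-nonneg {zero}  _   = +≤+ z≤n
deg-nonneg {suc m} eff = ℤP.+-mono-≤ (eff zero) (deg-nonneg (λ i → eff (suc i)))

nonneg-+≡0 : {a b : ℤ} → 0ℤ ≤ a → 0ℤ ≤ b → a + b ≡ 0ℤ → a ≡ 0ℤ × b ≡ 0ℤ
nonneg-+≡0 {+ 0} {+ 0} _ _ _ = refl , refl

nonneg-+≡1 : {a b : ℤ} → 0ℤ ≤ a → 0ℤ ≤ b → a + b ≡ 1ℤ → (a ≡ 0ℤ × b ≡ 1ℤ) ⊎ (a ≡ 1ℤ × b ≡ 0ℤ)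
nonneg-+≡1 {+ 0} {+ 1} _ _ _ = inj₁ (refl , refl)
nonneg-+≡1 {+ 1} {+ 0} _ _ _ = inj₂ (refl , refl)

effective-deg-zero : {D : Div m} → Effective D → deg D ≡ 0ℤ → D ≗ zeroDiv
effective-deg-zero {suc m} eff deg≡0 with nonneg-+≡0 (eff zero) (deg-nonneg (λ i → eff (suc i))) deg≡0
... | D₀≡0 , rest≡0 = λ { zero → D₀≡0 ; (suc i) → effective-deg-zero (λ i → eff (suc i)) rest≡0 i }

effective-deg-one : {D : Div m} → Effective D → deg D ≡ 1ℤ → ∃ λ w → D ≗ δ w
effective-deg-one {suc m} eff deg≡1 with nonneg-+≡1 (eff zero) (deg-nonneg (λ i → eff (suc i))) deg≡1
... | inj₁ (D₀≡0 , rest≡1) =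
  let w , rest≗δw = effective-deg-one (λ i → eff (suc i)) rest≡1
  in suc w , λ { zero → D₀≡0 ; (suc i) → trans (rest≗δw i) (sym (δ-suc w i)) }
... | inj₂ (D₀≡1 , rest≡0) =
  zero , λ { zero → D₀≡1 ; (suc i) → effective-deg-zero (λ i → eff (suc i)) rest≡0 i }

module _ (G : Graph) where

  rankGE1⇒linEq-δ : (D : Div (n G)) → deg D ≡ + 2 → RankGE G D 1 →
                    ∀ v → ∃ λ w → LinEq G (D ⊖ δ v) (δ w)
  rankGE1⇒linEq-δ D deg≡2 r v =
    let F , F-eff , D-v~F = r (δ v) (δ-effective v) (deg-δ v)
        deg-F≡1 = trans (sym (linEq⇒deg≡ G D-v~F)) (trans (deg-⊖ D (δ v)) (cong₂ _-_ deg≡2 (deg-δ v)))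
        w , F≗δw = effective-deg-one F-eff deg-F≡1
    in w , linEq-resp G {D ⊖ δ v} (λ _ → refl) F≗δw D-v~F

  linEq-δ⇒rankGE1 : (D : Div (n G)) → (∀ v → ∃ λ w → LinEq G (D ⊖ δ v) (δ w)) → RankGE G D 1
  linEq-δ⇒rankGE1 D shift E E-eff deg≡1 =
    let v , E≗δv = effective-deg-one E-eff deg≡1
        w , D-v~w = shift v
    in δ w , δ-effective w ,
       linEq-resp G {E′ = δ w} (λ i → cong (λ x → D i - x) (sym (E≗δv i))) (λ _ → refl) D-v~w

zetaCoeff-none : (G : Graph) {d : ℤ} {k : ℕ} → (∀ D → deg D ≡ d → RankGE G D k → ⊥) → ZetaCoeff G d k 0
zetaCoeff-none G none = [] , refl , [] , [] , λ D deg≡ r → ⊥-elim (none D deg≡ r)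

zetaCoeff-unique : (G : Graph) {d : ℤ} {k : ℕ} (D₀ : Div (n G)) → deg D₀ ≡ d → RankGE G D₀ k →
                   (∀ D → deg D ≡ d → RankGE G D k → LinEq G D D₀) → ZetaCoeff G d k 1
zetaCoeff-unique G D₀ deg≡ r unique =
  D₀ ∷ [] , refl , (deg≡ , r) ∷ [] , [] ∷ [] , λ D deg≡ r → here (unique D deg≡ r)

-- A certificate that D ↦ ⟨ weight , D ⟩ mod N identifies Jac(G) with ℤ/N: harmonicity modulo N
-- makes it vanish on principal divisors, and relation and cycle exhibit
-- δ i − δ base − (weight i)·generator and N·generator as principal.
record CyclicJacobian (G : Graph) (N : ℕ) : Set where
  field
    weight           : Div (n G)
    weight-harmonic  : ∀ i → + N ∣ laplacian G weight i
    generator        : Div (n G)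
    generator-deg    : deg generator ≡ 0ℤ
    generator-weight : ⟨ weight , generator ⟩ ≡ 1ℤ
    base             : Fin (n G)
    relation         : Fin (n G) → Div (n G)
    relation-spec    : ∀ i j → laplacian G (relation i) j ≡ δ i j - δ base j - weight i * generator j
    cycle            : Div (n G)
    cycle-spec       : ∀ j → laplacian G cycle j ≡ + N * generator j

cyclicJacobian : (G : Graph) (N : ℕ) (weight generator : Div (n G)) (base : Fin (n G))
                 (relation : Fin (n G) → Div (n G)) (cycle : Div (n G)) →
  {True (all? λ i → + N ∣? laplacian G weight i)} →
  {True (deg generator ℤ.≟ 0ℤ)} →
  {True (⟨ weight , generator ⟩ ℤ.≟ 1ℤ)} →
  {True (all? λ i → all? λ j → laplacian G (relation i) j ℤ.≟ δ i j - δ base j - weight i * generator j)} →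
  {True (all? λ j → laplacian G cycle j ℤ.≟ + N * generator j)} →
  CyclicJacobian G N
cyclicJacobian G N weight generator base relation cycle {h} {d} {w} {r} {c} = record
  { weight = weight ; weight-harmonic = toWitness h
  ; generator = generator ; generator-deg = toWitness d ; generator-weight = toWitness w
  ; base = base ; relation = relation ; relation-spec = toWitness r
  ; cycle = cycle ; cycle-spec = toWitness c }

module CyclicJacobianProperties {G : Graph} {N : ℕ} (J : CyclicJacobian G N) where
  open CyclicJacobian J public

  ψ : Div (n G) → ℤ
  ψ D = ⟨ weight , D ⟩

  linEq⇒∣ψ : {D E : Div (n G)} → LinEq G D E → + N ∣ ψ D - ψ E
  linEq⇒∣ψ {D} {E} (z , Δz) =
    subst (+ N ∣_) (sym (trans (sym (⟨⟩-⊖ʳ weight D E)) (⟨⟩-congʳ weight Δz)))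
          (∣⟨⟩-laplacian G weight weight-harmonic z)

  laplacian-Σrelation : (X : Div (n G)) (j : Fin (n G)) →
    laplacian G (λ k → deg (λ i → X i * relation i k)) j ≡ X j - deg X * δ base j - ψ X * generator j
  laplacian-Σrelation X j = begin
    laplacian G (λ k → deg (λ i → X i * relation i k)) j
      ≡⟨ laplacian-Σ G (λ i k → X i * relation i k) j ⟩
    deg (λ i → laplacian G (λ k → X i * relation i k) j)
      ≡⟨ deg-cong (λ i → trans (laplacian-scale G (X i) (relation i) j) (cong (X i *_) (relation-spec i j))) ⟩
    deg (λ i → X i * (δ i j - b - weight i * g))
      ≡⟨ deg-cong (λ i → expand (X i) (δ i j) b (weight i) g) ⟩
    deg (λ i → δ i j * X i - b * X i - g * (weight i * X i))
      ≡⟨ trans (deg-⊖ (λ i → δ i j * X i - b * X i) (λ i → g * (weight i * X i)))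
               (cong₂ _-_ (deg-⊖ (λ i → δ i j * X i) (λ i → b * X i)) (deg-scale g (λ i → weight i * X i))) ⟩
    deg (λ i → δ i j * X i) - deg (λ i → b * X i) - g * ψ X
      ≡⟨ cong₂ (λ x y → x - y - g * ψ X)
               (trans (deg-cong (λ i → cong (_* X i) (δ-comm i j))) (deg-δ* j X)) (deg-scale b X) ⟩
    X j - b * deg X - g * ψ X
      ≡⟨ cong₂ (λ x y → X j - x - y) (ℤP.*-comm b (deg X)) (ℤP.*-comm g (ψ X)) ⟩
    X j - deg X * b - ψ X * g ∎
    where
    open ≡-Reasoning
    b = δ base j
    g = generator j
    expand : ∀ x d b c g → x * (d - b - c * g) ≡ d * x - b * x - g * (c * x)
    expand = solve-∀

  ∣ψ⇒linEq : {D E : Div (n G)} → deg D ≡ deg E → + N ∣ ψ D - ψ E → LinEq G D E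
  ∣ψ⇒linEq {D} {E} deg≡ (divides q ψ≡) = z , λ j → sym (begin
    laplacian G z j
      ≡⟨ laplacian-⊕ G Σrelation (λ k → q * cycle k) j ⟩
    laplacian G Σrelation j + laplacian G (λ k → q * cycle k) j
      ≡⟨ cong₂ _+_ (laplacian-Σrelation X j) (trans (laplacian-scale G q cycle j) (cong (q *_) (cycle-spec j))) ⟩
    X j - deg X * δ base j - ψ X * generator j + q * (+ N * generator j)
      ≡⟨ cong₂ (λ d s → X j - d * δ base j - s * generator j + q * (+ N * generator j)) degX≡0 ψX≡qN ⟩
    X j - 0ℤ * δ base j - q * + N * generator j + q * (+ N * generator j)
      ≡⟨ cancel (X j) (δ base j) q (+ N) (generator j) ⟩
    X j ∎)
    where
    open ≡-Reasoning
    X = D ⊖ E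
    Σrelation : Div (n G)
    Σrelation k = deg (λ i → X i * relation i k)
    z = Σrelation ⊕ (λ k → q * cycle k)
    degX≡0 : deg X ≡ 0ℤ
    degX≡0 = trans (deg-⊖ D E) (ℤP.i≡j⇒i-j≡0 deg≡)
    ψX≡qN : ψ X ≡ q * + N
    ψX≡qN = trans (⟨⟩-⊖ʳ weight D E) ψ≡
    cancel : ∀ x b q N g → x - 0ℤ * b - q * N * g + q * (N * g) ≡ x
    cancel = solve-∀

  ≡ψ⇒linEq : {D E : Div (n G)} → deg D ≡ deg E → ψ D ≡ ψ E → LinEq G D E
  ≡ψ⇒linEq {D} {E} deg≡ ψ≡ = ∣ψ⇒linEq deg≡ (divides 0ℤ (trans (ℤP.i≡j⇒i-j≡0 ψ≡) (sym (ℤP.*-zeroˡ (+ N)))))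

  ∣ψ⇒linEq₀ : (D E : Div₀ (n G)) → + N ∣ ψ (proj₁ D) - ψ (proj₁ E) → LinEq G (proj₁ D) (proj₁ E)
  ∣ψ⇒linEq₀ (_ , deg≡0) (_ , deg≡0′) = ∣ψ⇒linEq (trans deg≡0 (sym deg≡0′))

  ≡ψ⇒linEq₀ : (D E : Div₀ (n G)) → ψ (proj₁ D) ≡ ψ (proj₁ E) → LinEq G (proj₁ D) (proj₁ E)
  ≡ψ⇒linEq₀ (_ , deg≡0) (_ , deg≡0′) = ≡ψ⇒linEq (trans deg≡0 (sym deg≡0′))

  scaledGenerator : ℤ → Div₀ (n G)
  scaledGenerator s = (λ i → s * generator i) ,
    trans (deg-scale s generator) (trans (cong (s *_) generator-deg) (ℤP.*-zeroʳ s))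

  ψ-scaledGenerator : (s : ℤ) → ψ (proj₁ (scaledGenerator s)) ≡ s
  ψ-scaledGenerator s =
    trans (⟨⟩-scaleʳ weight s generator) (trans (cong (s *_) generator-weight) (ℤP.*-identityʳ s))

  Rank1Residue : ℤ → Set
  Rank1Residue s = ∀ v → ∃ λ w → + N ∣ s - (weight v + weight w)

  rank1Residue? : (s : ℤ) → Dec (Rank1Residue s)
  rank1Residue? s = all? λ v → any? λ w → + N ∣? s - (weight v + weight w)

  rank1Residue-resp : {s s′ : ℤ} → + N ∣ s′ - s → Rank1Residue s → Rank1Residue s′
  rank1Residue-resp {s} {s′} N∣s′-s res v =
    let w , N∣s-vw = res v
    in w , subst (+ N ∣_) (telescope s′ s (weight v + weight w)) (∣m∣n⇒∣m+n N∣s′-s N∣s-vw)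
    where
    telescope : ∀ a b c → (a - b) + (b - c) ≡ a - c
    telescope = solve-∀

  ψ-δ⊖ : (D : Div (n G)) (v w : Fin (n G)) → ψ (D ⊖ δ v) - ψ (δ w) ≡ ψ D - (weight v + weight w)
  ψ-δ⊖ D v w = begin
    ψ (D ⊖ δ v) - ψ (δ w)                ≡⟨ cong₂ _-_ (⟨⟩-⊖ʳ weight D (δ v)) (⟨⟩-δʳ weight w) ⟩
    ψ D - ψ (δ v) - weight w             ≡⟨ cong (λ x → ψ D - x - weight w) (⟨⟩-δʳ weight v) ⟩
    ψ D - weight v - weight w            ≡⟨ regroup (ψ D) (weight v) (weight w) ⟩
    ψ D - (weight v + weight w)          ∎
    where
    open ≡-Reasoning
    regroup : ∀ a b c → a - b - c ≡ a - (b + c)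
    regroup = solve-∀

  rankGE1⇒rank1Residue : (D : Div (n G)) → deg D ≡ + 2 → RankGE G D 1 → Rank1Residue (ψ D)
  rankGE1⇒rank1Residue D deg≡2 r v =
    let w , D-v~w = rankGE1⇒linEq-δ G D deg≡2 r v
    in w , subst (+ N ∣_) (ψ-δ⊖ D v w) (linEq⇒∣ψ D-v~w)

  rank1Residue⇒rankGE1 : (D : Div (n G)) → deg D ≡ + 2 → Rank1Residue (ψ D) → RankGE G D 1
  rank1Residue⇒rankGE1 D deg≡2 res = linEq-δ⇒rankGE1 G D λ v →
    let w , N∣ = res v
        deg≡ = trans (deg-⊖ D (δ v)) (trans (cong₂ _-_ deg≡2 (deg-δ v)) (sym (deg-δ w)))
    in w , ∣ψ⇒linEq {D ⊖ δ v} deg≡ (subst (+ N ∣_) (sym (ψ-δ⊖ D v w)) N∣)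

  rankGE1⇒linEq-pair : (D : Div (n G)) → deg D ≡ + 2 → RankGE G D 1 → ∀ v →
    ∃ λ w → LinEq G D (δ v ⊕ δ w) × Rank1Residue (weight v + weight w)
  rankGE1⇒linEq-pair D deg≡2 r v =
    let res = rankGE1⇒rank1Residue D deg≡2 r
        w , N∣ = res v
        ψ-pair = trans (⟨⟩-⊕ʳ weight (δ v) (δ w)) (cong₂ _+_ (⟨⟩-δʳ weight v) (⟨⟩-δʳ weight w))
        deg-pair = trans (deg-⊕ (δ v) (δ w)) (cong₂ _+_ (deg-δ v) (deg-δ w))
    in w , ∣ψ⇒linEq (trans deg≡2 (sym deg-pair)) (subst (λ x → + N ∣ ψ D - x) (sym ψ-pair) N∣)
         , rank1Residue-resp {ψ D} {weight v + weight w} (∣-sym {ψ D} N∣) res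
    where
    ∣-sym : {a b : ℤ} → + N ∣ a - b → + N ∣ b - a
    ∣-sym {a} {b} N∣a-b = subst (+ N ∣_) (negate a b) (∣m⇒∣-m N∣a-b)
      where negate : ∀ a b → - (a - b) ≡ b - a
            negate = solve-∀

cyclicJacobian⇒JacIso : {G G′ : Graph} {N : ℕ} → CyclicJacobian G N → CyclicJacobian G′ N → JacIso G G′
cyclicJacobian⇒JacIso {G} {G′} {N} J J′ = φ , record
  { isGroupMonomorphism = record
    { isGroupHomomorphism = record
      { isMonoidHomomorphism = record
        { isMagmaHomomorphism = record
          { isRelHomomorphism = record
            { cong = λ {x} {y} x~y →
                J′.∣ψ⇒linEq₀ (φ x) (φ y) (∣-resp (sym (ψ′φ x)) (sym (ψ′φ y)) (J.linEq⇒∣ψ x~y)) }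
          ; homo = λ x y → J′.≡ψ⇒linEq₀ (φ (x ∙ y)) (φ x ∙′ φ y) (begin
              J′.ψ (proj₁ (φ (x ∙ y)))               ≡⟨ ψ′φ (x ∙ y) ⟩
              J.ψ (proj₁ x ⊕ proj₁ y)                ≡⟨ ⟨⟩-⊕ʳ J.weight (proj₁ x) (proj₁ y) ⟩
              J.ψ (proj₁ x) + J.ψ (proj₁ y)          ≡⟨ sym (cong₂ _+_ (ψ′φ x) (ψ′φ y)) ⟩
              J′.ψ (proj₁ (φ x)) + J′.ψ (proj₁ (φ y)) ≡⟨ sym (⟨⟩-⊕ʳ J′.weight (proj₁ (φ x)) (proj₁ (φ y))) ⟩
              J′.ψ (proj₁ (φ x ∙′ φ y))              ∎) }
        ; ε-homo = J′.≡ψ⇒linEq₀ (φ ε) ε′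
                     (trans (ψ′φ ε) (trans (⟨⟩-zeroʳ J.weight) (sym (⟨⟩-zeroʳ J′.weight)))) }
      ; ⁻¹-homo = λ x → J′.≡ψ⇒linEq₀ (φ (x ⁻¹)) (φ x ⁻¹′) (begin
          J′.ψ (proj₁ (φ (x ⁻¹)))   ≡⟨ ψ′φ (x ⁻¹) ⟩
          J.ψ (⊝ proj₁ x)           ≡⟨ ⟨⟩-⊝ʳ J.weight (proj₁ x) ⟩
          - J.ψ (proj₁ x)           ≡⟨ sym (cong -_ (ψ′φ x)) ⟩
          - J′.ψ (proj₁ (φ x))      ≡⟨ sym (⟨⟩-⊝ʳ J′.weight (proj₁ (φ x))) ⟩
          J′.ψ (proj₁ (φ x ⁻¹′))    ∎) }
    ; injective = λ {x} {y} φx~φy → J.∣ψ⇒linEq₀ x y (∣-resp (ψ′φ x) (ψ′φ y) (J′.linEq⇒∣ψ φx~φy)) }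
  ; surjective = λ y → φ⁻ y , λ {x} x~φ⁻y →
      J′.∣ψ⇒linEq₀ (φ x) y
        (∣-resp (sym (ψ′φ x)) (J.ψ-scaledGenerator (J′.ψ (proj₁ y))) (J.linEq⇒∣ψ x~φ⁻y)) }
  where
  module J = CyclicJacobianProperties J
  module J′ = CyclicJacobianProperties J′
  open RawGroup (Jac G)
  open RawGroup (Jac G′) using () renaming (_∙_ to _∙′_; ε to ε′; _⁻¹ to _⁻¹′)
  open ≡-Reasoning

  φ : Div₀ (n G) → Div₀ (n G′)
  φ D = J′.scaledGenerator (J.ψ (proj₁ D))

  φ⁻ : Div₀ (n G′) → Div₀ (n G)
  φ⁻ D = J.scaledGenerator (J′.ψ (proj₁ D))

  ψ′φ : ∀ D → J′.ψ (proj₁ (φ D)) ≡ J.ψ (proj₁ D)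
  ψ′φ D = J′.ψ-scaledGenerator (J.ψ (proj₁ D))

  ∣-resp : {a a′ b b′ : ℤ} → a ≡ a′ → b ≡ b′ → + N ∣ a - b → + N ∣ a′ - b′
  ∣-resp refl refl = λ N∣ → N∣

-- Rank via memoised reachability, and the Tutte polynomial

any-cong : {X : Set} {p q : X → Bool} → p ≗ q → any p ≗ any q
any-cong p≗q xs = cong or (map-cong p≗q xs)

countFin-cong : (m : ℕ) {p q : Fin m → Bool} → p ≗ q → countFin m p ≡ countFin m q
countFin-cong zero    p≗q = refl
countFin-cong (suc m) p≗q =
  cong₂ ℕ._+_ (cong (λ b → if b then 1 else 0) (p≗q zero)) (countFin-cong m (λ i → p≗q (suc i)))

reachStep : List (Edge m) → (Fin m → Bool) → Fin m → Bool
reachStep A R v =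
  R v ∨ any (λ e → (R (proj₁ e) ∧ ⌊ proj₂ e ≟ v ⌋) ∨ (R (proj₂ e) ∧ ⌊ proj₁ e ≟ v ⌋)) A

reachStep-cong : (A : List (Edge m)) {R R′ : Fin m → Bool} → R ≗ R′ → reachStep A R ≗ reachStep A R′
reachStep-cong A R≗R′ v = cong₂ _∨_ (R≗R′ v) (any-cong (λ (a , b) →
  cong₂ _∨_ (cong (_∧ ⌊ b ≟ v ⌋) (R≗R′ a)) (cong (_∧ ⌊ a ≟ v ⌋) (R≗R′ b))) A)

reachVec : ℕ → List (Edge m) → Fin m → Vec Bool m
reachVec zero    A u = tabulate (λ v → ⌊ u ≟ v ⌋)
reachVec (suc k) A u = tabulate (reachStep A (lookup (reachVec k A u)))

reachIn≡reachVec : (k : ℕ) (A : List (Edge m)) (u : Fin m) → reachIn k A u ≗ lookup (reachVec k A u)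
reachIn≡reachVec zero    A u v = sym (lookup∘tabulate (λ v → ⌊ u ≟ v ⌋) v)
reachIn≡reachVec (suc k) A u v =
  trans (reachStep-cong A (reachIn≡reachVec k A u) v)
        (sym (lookup∘tabulate (reachStep A (lookup (reachVec k A u))) v))

-- Opaque because symbolic unfolding loses the sharing in reachVec and grows exponentially;
-- only closed instances unfold it.
opaque
  fastReach : List (Edge m) → Fin m → Fin m → Bool
  fastReach {m} A u = lookup (reachVec m A u)

  reach≡fastReach : (A : List (Edge m)) (u : Fin m) → reach A u ≗ fastReach A u
  reach≡fastReach {m} A u = reachIn≡reachVec m A u

anyFin : (Fin m → Bool) → Bool
anyFin {zero}  p = false
anyFin {suc m} p = p zero ∨ anyFin (λ i → p (suc i))

anyFin-cong : {p q : Fin m → Bool} → p ≗ q → anyFin p ≡ anyFin q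
anyFin-cong {zero}  p≗q = refl
anyFin-cong {suc m} p≗q = cong₂ _∨_ (p≗q zero) (anyFin-cong (λ i → p≗q (suc i)))

componentsBy : (Fin m → Fin m → Bool) → ℕ
componentsBy {m} R = countFin m (λ v → not (anyFin (λ u → ⌊ u Fin.<? v ⌋ ∧ R u v)))

componentsBy-cong : {R R′ : Fin m → Fin m → Bool} → (∀ u → R u ≗ R′ u) → componentsBy R ≡ componentsBy R′
componentsBy-cong {m} R≗R′ =
  countFin-cong m (λ v → cong not (anyFin-cong (λ u → cong (⌊ u Fin.<? v ⌋ ∧_) (R≗R′ u v))))

fastRank : List (Edge m) → ℕ
fastRank {m} A = m ∸ componentsBy (fastReach A)

rank≡fastRank : (A : List (Edge 6)) → rank A ≡ fastRank A
rank≡fastRank A = cong (6 ∸_) (trans (components≡componentsBy A) (componentsBy-cong (reach≡fastReach A)))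
  where
  -- Holds definitionally only for a concrete vertex count, as Defs.components uses a local anyFin.
  components≡componentsBy : (A : List (Edge 6)) → components A ≡ componentsBy (reach A)
  components≡componentsBy A = refl

sumℤ-pointwise : {X Y : Set} {R : X → Y → Set} {f : X → ℤ} {g : Y → ℤ} →
                 (∀ {x y} → R x y → f x ≡ g y) → {xs : List X} {ys : List Y} →
                 Pointwise R xs ys → sumℤ xs f ≡ sumℤ ys g
sumℤ-pointwise f≡g []            = refl
sumℤ-pointwise f≡g (Rxy ∷ Rxsys) = cong₂ _+_ (f≡g Rxy) (sumℤ-pointwise f≡g Rxsys)

SameRankAndSize : {m m′ : ℕ} → List (Edge m) → List (Edge m′) → Set
SameRankAndSize A B = rank A ≡ rank B × length A ≡ length B

sameRankAndSize⇒TutteEq : (G G′ : Graph) → rank (edges G) ≡ rank (edges G′) →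
  Pointwise SameRankAndSize (sublists (edges G)) (sublists (edges G′)) → TutteEq G G′
sameRankAndSize⇒TutteEq G G′ rank≡ same i j =
  trans (sumℤ-pointwise (λ (r≡ , l≡) → cong₂ (term (rank (edges G))) r≡ l≡) same)
        (cong (λ r → sumℤ (sublists (edges G′)) λ A → term r (rank A) (length A)) rank≡)
  where
  term : ℕ → ℕ → ℕ → ℤ
  term rank-E rank-A size-A = coeffPow (rank-E ∸ rank-A) i * coeffPow (size-A ∸ rank-A) j

-- The two graphs

mkGraph : (k : ℕ) (E : List (Edge (suc k))) →
          {True (All.all? (λ e → proj₁ e Fin.<? proj₂ e) E)} →
          {True (allPairs? (λ e e′ → ¬? (×.≡-dec _≟_ _≟_ e e′)) E)} →
          (∀ u v → T (fastReach E u v)) → Graph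
mkGraph k E {noLoops} {simple} connected = record
  { n         = suc k
  ; edges     = E
  ; noLoops   = toWitness noLoops
  ; simple    = toWitness simple
  ; nonempty  = s≤s z≤n
  ; connected = λ u v → subst T (sym (reach≡fastReach E u v)) (connected u v)
  }

E₁ E₂ : List (Edge 6)
E₁ = (# 0 , # 1) ∷ (# 0 , # 2) ∷ (# 0 , # 3) ∷ (# 1 , # 2) ∷ (# 1 , # 3)
   ∷ (# 0 , # 4) ∷ (# 0 , # 5) ∷ (# 4 , # 5) ∷ []
E₂ = (# 0 , # 1) ∷ (# 0 , # 2) ∷ (# 0 , # 3) ∷ (# 1 , # 2) ∷ (# 1 , # 3)
   ∷ (# 2 , # 4) ∷ (# 2 , # 5) ∷ (# 4 , # 5) ∷ []

opaque
  unfolding fastReach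

  E₁-connected : ∀ u v → T (fastReach E₁ u v)
  E₁-connected = from-yes (all? λ u → all? λ v → T? (fastReach E₁ u v))

  E₂-connected : ∀ u v → T (fastReach E₂ u v)
  E₂-connected = from-yes (all? λ u → all? λ v → T? (fastReach E₂ u v))

G₁ G₂ : Graph
G₁ = mkGraph 5 E₁ E₁-connected
G₂ = mkGraph 5 E₂ E₂-connected

opaque
  unfolding fastReach

  sublists-sameFastRank : Pointwise (λ A B → fastRank A ≡ fastRank B × length A ≡ length B)
                                    (sublists E₁) (sublists E₂)
  sublists-sameFastRank = from-yes (Pointwise.decidable
    (λ A B → (fastRank A ℕ.≟ fastRank B) ×-dec (length A ℕ.≟ length B)) (sublists E₁) (sublists E₂))

  fastRank-E₁≡E₂ : fastRank E₁ ≡ fastRank E₂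
  fastRank-E₁≡E₂ = refl

tutteEq : TutteEq G₁ G₂
tutteEq = sameRankAndSize⇒TutteEq G₁ G₂ (fastRank⇒rank fastRank-E₁≡E₂)
  (Pointwise.map (λ (r≡ , l≡) → fastRank⇒rank r≡ , l≡) sublists-sameFastRank)
  where
  fastRank⇒rank : {A B : List (Edge 6)} → fastRank A ≡ fastRank B → rank A ≡ rank B
  fastRank⇒rank {A} {B} eq = trans (rank≡fastRank A) (trans eq (sym (rank≡fastRank B)))

-- relation i and cycle solve the Laplacian systems of the certificate, normalised by z₀ = 0.
J₁ : CyclicJacobian G₁ 24
J₁ = cyclicJacobian G₁ 24
  (lookup (0 ∷ 6 ∷ 3 ∷ 15 ∷ 8 ∷ 16 ∷ []))
  (lookup (-2 ∷ 0 ∷ 3 ∷ 0 ∷ -1 ∷ 0 ∷ []))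
  zero
  (λ i → lookup (lookup ( (0 ∷   0 ∷   0 ∷  0 ∷   0 ∷ 0 ∷ [])
                        ∷ (0 ∷  -4 ∷ -11 ∷ -2 ∷   4 ∷ 2 ∷ [])
                        ∷ (0 ∷  -2 ∷  -5 ∷ -1 ∷   2 ∷ 1 ∷ [])
                        ∷ (0 ∷ -11 ∷ -28 ∷ -5 ∷  10 ∷ 5 ∷ [])
                        ∷ (0 ∷  -6 ∷ -15 ∷ -3 ∷   6 ∷ 3 ∷ [])
                        ∷ (0 ∷ -12 ∷ -30 ∷ -6 ∷  11 ∷ 6 ∷ []) ∷ []) i))
  (lookup (0 ∷ 18 ∷ 45 ∷ 9 ∷ -16 ∷ -8 ∷ []))

J₂ : CyclicJacobian G₂ 24
J₂ = cyclicJacobian G₂ 24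
  (lookup (0 ∷ 18 ∷ 9 ∷ 21 ∷ 1 ∷ 17 ∷ []))
  (lookup (-1 ∷ 0 ∷ 0 ∷ 0 ∷ 1 ∷ 0 ∷ []))
  zero
  (λ i → lookup (lookup ( (0 ∷  0 ∷   0 ∷  0 ∷   0 ∷   0 ∷ [])
                        ∷ (0 ∷ -4 ∷ -11 ∷ -2 ∷ -23 ∷ -17 ∷ [])
                        ∷ (0 ∷ -2 ∷  -5 ∷ -1 ∷ -11 ∷  -8 ∷ [])
                        ∷ (0 ∷ -5 ∷ -13 ∷ -2 ∷ -27 ∷ -20 ∷ [])
                        ∷ (0 ∷  0 ∷   0 ∷  0 ∷   0 ∷   0 ∷ [])
                        ∷ (0 ∷ -4 ∷ -10 ∷ -2 ∷ -21 ∷ -15 ∷ []) ∷ []) i))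
  (lookup (0 ∷ 6 ∷ 15 ∷ 3 ∷ 31 ∷ 23 ∷ []))

module J₁ = CyclicJacobianProperties J₁
module J₂ = CyclicJacobianProperties J₂

no-rank1-residue₁ : ∀ w → ¬ J₁.Rank1Residue (J₁.weight zero + J₁.weight w)
no-rank1-residue₁ = from-yes (all? λ w → ¬? (J₁.rank1Residue? (J₁.weight zero + J₁.weight w)))

zeta₁ : ZetaCoeff G₁ (+ 2) 1 0
zeta₁ = zetaCoeff-none G₁ λ D deg≡2 r →
  let w , _ , residue = J₁.rankGE1⇒linEq-pair D deg≡2 r zero in no-rank1-residue₁ w residue

unique-rank1-residue₂ : ∀ w → J₂.Rank1Residue (J₂.weight zero + J₂.weight w) → w ≡ # 1
unique-rank1-residue₂ = from-yes (all? λ w → J₂.rank1Residue? (J₂.weight zero + J₂.weight w) →-dec (w ≟ # 1))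

zeta₂ : ZetaCoeff G₂ (+ 2) 1 1
zeta₂ = zetaCoeff-unique G₂ (δ zero ⊕ δ (# 1)) refl
  (J₂.rank1Residue⇒rankGE1 (δ zero ⊕ δ (# 1)) refl (from-yes (J₂.rank1Residue? (J₂.ψ (δ zero ⊕ δ (# 1))))))
  λ D deg≡2 r → let w , D~pair , residue = J₂.rankGE1⇒linEq-pair D deg≡2 r zero
                in subst (λ w → LinEq G₂ D (δ zero ⊕ δ w)) (unique-rank1-residue₂ w residue) D~pair

theorem1p1 : Σ Graph λ G → Σ Graph λ G' → TutteEq G G' × JacIso G G' × ZetaDiffer G G'
theorem1p1 = G₁ , G₂ , tutteEq , cyclicJacobian⇒JacIso J₁ J₂ , (+ 2 , 1 , 0 , 1 , zeta₁ , zeta₂ , λ ())
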